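{- For every stump $U$ and every set $A\subseteq\overline{U}$ of finite sequences, if $A$ is almost-full, then there exists a stump $S$ that $U$-secures $A$.
   Context: The setting is intuitionistic mathematics, in which Brouwer's Thesis on bars in $\mathcal{N}$ is accepted: for every set $B$ of finite sequences such that every $\alpha\in\mathcal{N}$ has an initial segment in $B$, there is a stump $S$ such that every $\alpha\in\mathcal{N}$ has an initial segment in $S\cap B$. Logical constants are read constructively. $\mathcal{N}$ is the set of infinite sequences of natural numbers; $\langle\,\rangle$ is the empty sequence, $s\ast t$ concatenation, $\overline{\zeta}n=\langle\zeta(0),\ldots,\zeta(n-1)\rangle$; for finite sequences, $s\sqsubset t$ means $s$ is a proper initial segment of $t$. $[\omega]^\omega$ is the set of strictly increasing $\zeta\in\mathcal{N}$; $[\omega]^{<\omega}$ the set of strictly increasing finite sequences; $[n]^{<n+1}$ the strictly increasing finite sequences of length $\le n$ with all entries $<n$. $(\zeta\circ s)(i)=\zeta(s(i))$ and, for $u$ of length $n$ and $s$ with entries $<n$, $(u\circ s)(i)=u(s(i))$. $A$ is almost-full iff $\forall\zeta\in[\omega]^\omega\exists s\in[\omega]^{<\omega}[\zeta\circ s\in A]$. Stumps are generated inductively: $\emptyset$ is a stump; if $S_0,S_1,\ldots$ are stumps then $\{\langle\,\rangle\}\cup\bigcup_n\{\langle n\rangle\ast t\mid t\in S_n\}$ is a stump; nothing else. The border of a stump $U$ is $\overline{U}=\{s\mid s\notin U\wedge\forall t\sqsubset s[t\in U]\}$. For $A\subseteq\overline{U}$ and $u\in U\cup\overline{U}$: $u$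 $U$-secures $A$ iff either $u\in A$, or $u\in U$ and every $t\in\overline{U}$ with $u\sqsubset t$ lies in $A$. A stump $S$ $U$-secures $A$ iff $\exists m\forall\zeta\in[\omega]^\omega[\zeta(0)>m\rightarrow\exists n[\overline{\zeta}n\in S\wedge\exists s\in[n]^{<n+1}[\overline{\zeta}n\circ s\ U\text{ -secures }A]]]$. -}

module Defs where

open import Data.Nat using (ℕ; zero; suc; _<_; _≤_)
open import Data.List using (List; []; _∷_; _++_; map; applyUpTo; length)
open import Data.List.Relation.Unary.All using (All)
open import Data.List.Relation.Unary.Linked using (Linked)
open import Data.Product using (Σ; ∃; _×_)
open import Data.Sum using (_⊎_)
open import Data.Unit using (⊤)
open import Data.Empty using (⊥)
open import Relation.Nullary using (¬_)
open import Relation.Binary.PropositionalEquality using (_≡_)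

Seq : Set
Seq = List ℕ

Baire : Set
Baire = ℕ → ℕ

SeqSet : Set₁
SeqSet = Seq → Set

bar : Baire → ℕ → Seq
bar ζ n = applyUpTo ζ n

_⊏_ : Seq → Seq → Set
s ⊏ t = Σ ℕ λ x → Σ Seq λ r → s ++ (x ∷ r) ≡ t

-- Stumps, generated inductively: ∅, or {⟨⟩} ∪ ⋃ₙ {⟨n⟩ ∗ t | t ∈ Sₙ}.
data Stump : Set where
  empty : Stump
  node  : (ℕ → Stump) → Stump

_∈S_ : Seq → Stump → Set
_ ∈S empty = ⊥
[] ∈S node f = ⊤
(x ∷ t) ∈S node f = t ∈S f x

Border : Stump → SeqSet
Border U s = (¬ (s ∈S U)) × (∀ t → t ⊏ s → t ∈S U)

_⊆_ : SeqSet → SeqSet → Set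
A ⊆ B = ∀ s → A s → B s

StrictInc : Baire → Set
StrictInc ζ = ∀ i → ζ i < ζ (suc i)

StrictIncFin : Seq → Set
StrictIncFin s = Linked _<_ s

InitSubsets : ℕ → Seq → Set
InitSubsets n s = StrictIncFin s × (length s ≤ n) × All (λ i → i < n) s

_∘ᵇ_ : Baire → Seq → Seq
ζ ∘ᵇ s = map ζ s

-- total lookup with default 0 (only used at indices < length)
lookupD : Seq → ℕ → ℕ
lookupD [] _ = 0
lookupD (x ∷ u) zero = x
lookupD (x ∷ u) (suc i) = lookupD u i

-- u ∘ s  (for s with entries < length u)
_∘ˢ_ : Seq → Seq → Seq
u ∘ˢ s = map (lookupD u) s

AlmostFull : SeqSet → Set
AlmostFull A = ∀ ζ → StrictInc ζ → Σ Seq λ s → StrictIncFin s × A (ζ ∘ᵇ s)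

USecures : Stump → SeqSet → Seq → Set
USecures U A u = A u ⊎ ((u ∈S U) × (∀ t → Border U t → u ⊏ t → A t))

StumpSecures : Stump → Stump → SeqSet → Set
StumpSecures S U A =
  Σ ℕ λ m → ∀ ζ → StrictInc ζ → m < ζ 0 →
    Σ ℕ λ n → (bar ζ n ∈S S) ×
      (Σ Seq λ s → InitSubsets n s × USecures U A (bar ζ n ∘ˢ s))

-- Brouwer's Thesis on bars in N (an axiom of the setting)
BrouwersThesis : Set₁
BrouwersThesis =
  (B : SeqSet) → (∀ α → Σ ℕ λ n → B (bar α n)) →
  Σ Stump λ S → ∀ α → Σ ℕ λ n → (bar α n ∈S S) × B (bar α n)

{-# OPTIONS --safe #-}
-- A strictly increasing ζ with ζ 0 > 0 is determined by its gap sequence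
-- ζ 0 ∸ 1, ζ 1 ∸ suc (ζ 0), …, and every α ∈ 𝒩 is such a gap sequence.
-- Almost-fullness of A therefore says that "some subsequence of the sequence
-- with gaps ᾱn lies in A" bars 𝒩; Brouwer's Thesis yields a stump S for this
-- bar, and S pulled back along the gap correspondence U-secures A, each
-- ζ̄n ∘ s even lying in A itself.
module Submission where

open import Defs
open import Data.Product using (Σ; _×_; _,_)
open import Data.Nat using (ℕ; zero; suc; _+_; _∸_; _<_; _≤_; z≤n; s≤s)
open import Data.Nat.Properties
  using (≤-trans; n≤1+n; m≤m+n; m≤n+m; m<m+n; +-suc; m+[n∸m]≡n)
open import Data.List using ([]; _∷_; length)
open import Data.List.Properties using (length-applyUpTo)
open import Data.List.Relation.Unary.All as All using (All; []; _∷_)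
open import Data.Sum using (inj₁)
open import Relation.Binary.PropositionalEquality
  using (_≡_; refl; sym; trans; cong; cong₂; subst)

tail : Baire → Baire
tail α i = α (suc i)

accumulate : ℕ → Seq → Seq
accumulate p [] = []
accumulate p (x ∷ u) = (p + suc x) ∷ accumulate (p + suc x) u

differences : ℕ → Seq → Seq
differences p [] = []
differences p (y ∷ u) = (y ∸ suc p) ∷ differences y u

accumulateᴺ : ℕ → Baire → Baire
accumulateᴺ p α zero = p + suc (α 0)
accumulateᴺ p α (suc i) = accumulateᴺ (p + suc (α 0)) (tail α) i

differencesᴺ : ℕ → Baire → Baire
differencesᴺ p ζ zero = ζ 0 ∸ suc p
differencesᴺ p ζ (suc i) = differencesᴺ (ζ 0) (tail ζ) i

bar-accumulateᴺ : ∀ n p α → bar (accumulateᴺ p α) n ≡ accumulate p (bar α n)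
bar-accumulateᴺ zero p α = refl
bar-accumulateᴺ (suc n) p α = cong (_ ∷_) (bar-accumulateᴺ n (p + suc (α 0)) (tail α))

bar-differencesᴺ : ∀ n p ζ → bar (differencesᴺ p ζ) n ≡ differences p (bar ζ n)
bar-differencesᴺ zero p ζ = refl
bar-differencesᴺ (suc n) p ζ = cong (_ ∷_) (bar-differencesᴺ n (ζ 0) (tail ζ))

accumulateᴺ-strictInc : ∀ p α → StrictInc (accumulateᴺ p α)
accumulateᴺ-strictInc p α zero = m<m+n _ (s≤s z≤n)
accumulateᴺ-strictInc p α (suc i) = accumulateᴺ-strictInc (p + suc (α 0)) (tail α) i

accumulate-differences : ∀ n p ζ → StrictInc ζ → p < ζ 0 →
  accumulate p (differences p (bar ζ n)) ≡ bar ζ n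
accumulate-differences zero p ζ inc p<ζ₀ = refl
accumulate-differences (suc n) p ζ inc p<ζ₀ =
  cong₂ _∷_ head-eq
    (trans (cong (λ q → accumulate q (differences (ζ 0) (bar (tail ζ) n))) head-eq)
           (accumulate-differences n (ζ 0) (tail ζ) (λ i → inc (suc i)) (inc 0)))
  where
  head-eq : p + suc (ζ 0 ∸ suc p) ≡ ζ 0
  head-eq = trans (+-suc p _) (m+[n∸m]≡n p<ζ₀)

differences⁻¹ : ℕ → Stump → Stump
differences⁻¹ p empty = empty
differences⁻¹ p (node f) = node (λ y → differences⁻¹ y (f (y ∸ suc p)))

∈-differences⁻¹ : ∀ S p u → differences p u ∈S S → u ∈S differences⁻¹ p S
∈-differences⁻¹ (node f) p [] h = h
∈-differences⁻¹ (node f) p (y ∷ u) h = ∈-differences⁻¹ (f (y ∸ suc p)) y u h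

entryBound : Seq → ℕ
entryBound [] = 0
entryBound (x ∷ s) = suc (x + entryBound s)

all-<-entryBound : ∀ s → All (_< entryBound s) s
all-<-entryBound [] = []
all-<-entryBound (x ∷ s) =
  s≤s (m≤m+n x _) ∷ All.map (λ y<b → ≤-trans y<b (≤-trans (m≤n+m _ x) (n≤1+n _))) (all-<-entryBound s)

length≤entryBound : ∀ s → length s ≤ entryBound s
length≤entryBound [] = z≤n
length≤entryBound (x ∷ s) = s≤s (≤-trans (length≤entryBound s) (m≤n+m _ x))

lookupD-bar : ∀ f n i → i < n → lookupD (bar f n) i ≡ f i
lookupD-bar f (suc n) zero i<n = refl
lookupD-bar f (suc n) (suc i) (s≤s i<n) = lookupD-bar (tail f) n i i<n

bar-∘ˢ : ∀ f n s → All (_< n) s → bar f n ∘ˢ s ≡ f ∘ᵇ s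
bar-∘ˢ f n [] [] = refl
bar-∘ˢ f n (i ∷ s) (i<n ∷ s<n) = cong₂ _∷_ (lookupD-bar f n i i<n) (bar-∘ˢ f n s s<n)

SubsequenceIn : SeqSet → SeqSet
SubsequenceIn A u = Σ Seq λ s → InitSubsets (length u) s × A (accumulate 0 u ∘ˢ s)

almostFull⇒subsequenceBar : ∀ A → AlmostFull A → ∀ α → Σ ℕ λ n → SubsequenceIn A (bar α n)
almostFull⇒subsequenceBar A af α with af (accumulateᴺ 0 α) (accumulateᴺ-strictInc 0 α)
... | s , s-inc , ζ∘s∈A = n , s , init , subst A (sym ζ̄n∘s≡ζ∘s) ζ∘s∈A
  where
  n = entryBound s
  init : InitSubsets (length (bar α n)) s
  init = subst (λ k → InitSubsets k s) (sym (length-applyUpTo α n))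
           (s-inc , length≤entryBound s , all-<-entryBound s)
  ζ̄n∘s≡ζ∘s : accumulate 0 (bar α n) ∘ˢ s ≡ accumulateᴺ 0 α ∘ᵇ s
  ζ̄n∘s≡ζ∘s = trans (cong (_∘ˢ s) (sym (bar-accumulateᴺ n 0 α)))
                   (bar-∘ˢ (accumulateᴺ 0 α) n s (all-<-entryBound s))

-- Every u is secured through its first alternative u ∈ A.
corollary18p9 : BrouwersThesis → (U : Stump) → (A : SeqSet) → A ⊆ Border U →
    AlmostFull A → Σ Stump λ S → StumpSecures S U A
corollary18p9 bt U A _ af with bt (SubsequenceIn A) (almostFull⇒subsequenceBar A af)
... | S , S-bars = differences⁻¹ 0 S , 0 , secured
  where
  secured : ∀ ζ → StrictInc ζ → 0 < ζ 0 → Σ ℕ λ n → (bar ζ n ∈S differences⁻¹ 0 S) ×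
              (Σ Seq λ s → InitSubsets n s × USecures U A (bar ζ n ∘ˢ s))
  secured ζ inc 0<ζ₀ with S-bars (differencesᴺ 0 ζ)
  ... | n , n∈S , s , init , a∈A =
    n , ∈-differences⁻¹ S 0 (bar ζ n) (subst (_∈S S) bar-eq n∈S)
      , s , subst (λ k → InitSubsets k s) (length-applyUpTo _ n) init
      , inj₁ (subst A (cong (_∘ˢ s) ζ̄n-eq) a∈A)
    where
    bar-eq : bar (differencesᴺ 0 ζ) n ≡ differences 0 (bar ζ n)
    bar-eq = bar-differencesᴺ n 0 ζ
    ζ̄n-eq : accumulate 0 (bar (differencesᴺ 0 ζ) n) ≡ bar ζ n
    ζ̄n-eq = trans (cong (accumulate 0) bar-eq) (accumulate-differences n 0 ζ inc 0<ζ₀)
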